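{- Let $f:\mathbb{B}^n\to\mathbb{B}^n$ be a Boolean network in which component $n$ is not autoregulated, with reduction $\tilde f$ by elimination of $n$, and let $T\in\{0,1,\star\}^n$ be a trap space for $f$. Then: (i) $T_{[n-1]}$ is a trap space for $\tilde f$; (ii) if $T$ is a minimal trap space for $f$ and $T_n\in\{0,1\}$, then $T_{[n-1]}$ is a minimal trap space for $\tilde f$; (iii) if $T$ is a minimal trap space for $f$ and $T_i\in\{0,1\}$ for every target $i$ of $n$, then $T_{[n-1]}$ is a minimal trap space for $\tilde f$.
   Context: $\mathbb{B}=\{0,1\}$, $[n]=\{1,\dots,n\}$; a Boolean network is a map $f:\mathbb{B}^n\to\mathbb{B}^n$. For $x\in\mathbb{B}^n$, $\bar x^i$ is $x$ with coordinate $i$ flipped. Component $i$ regulates $j$ (and $j$ is a target of $i$) if $f_j(x)\neq f_j(\bar x^i)$ for some $x$; $n$ is autoregulated if it regulates itself. A subspace is a set $\{x: x_i=c(i)\ \forall i\in I\}$, written as $S\in\{0,1,\star\}^n$ with $S_i=c(i)$ on $I$ (fixed) and $S_i=\star$ elsewhere (free). $A_J$ denotes the projection of $A\subseteq\mathbb{B}^n$ onto coordinates $J$. A trap space of $f$ is a subspace $T$ with $f(T)\subseteq T$; it is minimal if no trap space is strictly contained in it. Reduction: if $n$ is not autoregulated, $\sigma(x)=(x,f_n(x,0))$ for $x\in\mathbb{B}^{n-1}$ and $\tilde f:\mathbb{B}^{n-1}\to\mathbb{B}^{n-1}$ is $\tilde f_i(x)=f_i(\sigma(x))$. -}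

module Defs where

open import Data.Bool using (Bool; true; false; not)
open import Data.Maybe using (Maybe; just; nothing)
open import Data.Nat using (ℕ; suc)
open import Data.Fin using (Fin; fromℕ)
open import Data.Vec using (Vec; lookup; updateAt; init; _∷ʳ_)
open import Data.Product using (∃; _×_)
open import Relation.Binary.PropositionalEquality using (_≡_; _≢_)
open import Relation.Nullary using (¬_)

State : ℕ → Set
State n = Vec Bool n

BN : ℕ → Set
BN n = State n → State n

flip : ∀ {n} → Fin n → State n → State n
flip i x = updateAt x i not

Regulates : ∀ {n} → BN n → Fin n → Fin n → Set
Regulates f i j = ∃ λ x → lookup (f x) j ≢ lookup (f (flip i x)) j

Autoregulated : ∀ {n} → BN n → Fin n → Set
Autoregulated f i = Regulates f i i

-- Subspaces: nothing = ⋆ (free), just c = fixed to c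
Subspace : ℕ → Set
Subspace n = Vec (Maybe Bool) n

_∈S_ : ∀ {n} → State n → Subspace n → Set
x ∈S S = ∀ i b → lookup S i ≡ just b → lookup x i ≡ b

_⊆S_ : ∀ {n} → Subspace n → Subspace n → Set
S ⊆S T = ∀ x → x ∈S S → x ∈S T

Fixed : ∀ {n} → Subspace n → Fin n → Set
Fixed S i = ∃ λ b → lookup S i ≡ just b

IsTrapSpace : ∀ {n} → BN n → Subspace n → Set
IsTrapSpace f T = ∀ x → x ∈S T → f x ∈S T

IsMinimalTrapSpace : ∀ {n} → BN n → Subspace n → Set
IsMinimalTrapSpace f T =
  IsTrapSpace f T × (∀ T′ → IsTrapSpace f T′ → T′ ⊆S T → T ⊆S T′)

-- the last component (component n of a network on 𝔹^(m+1))
last : ∀ m → Fin (suc m)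
last m = fromℕ m

σ : ∀ {m} → BN (suc m) → State m → State (suc m)
σ {m} f x = x ∷ʳ lookup (f (x ∷ʳ false)) (last m)

reduce : ∀ {m} → BN (suc m) → BN m
reduce f x = init (f (σ f x))

proj : ∀ {m} → Subspace (suc m) → Subspace m
proj T = init T

module Submission where

-- Since f_n ignores x_n, σ(x) lies in T whenever x ∈ T_{[n-1]} (if T_n = b then
-- f_n(x,0) = f_n(x,b) = b), so f̃ = init ∘ f ∘ σ maps T_{[n-1]} into itself. For
-- minimality, take a trap space T′ ⊆ T_{[n-1]} of f̃. Its lift T′ × T_n lies in T
-- and is a trap space of f: if T_n is fixed, σ(x) is the only point of the lift
-- above x; if every target of n is fixed on T, each component of f either ignores
-- x_n, and then agrees with f̃, or is constant on T. Minimality of T gives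
-- T ⊆ T′ × T_n, hence T_{[n-1]} ⊆ T′.

open import Defs
open import Data.Bool using (Bool; true; false; not)
open import Data.Bool.Properties using (_≟_)
open import Data.Empty using (⊥-elim)
open import Data.Fin using (Fin; zero; suc; inject₁)
open import Data.Maybe using (Maybe; just)
open import Data.Maybe.Properties using (just-injective)
open import Data.Nat using (ℕ; suc)
open import Data.Product using (_×_; _,_; proj₁; map₁)
open import Data.Sum using (_⊎_; inj₁; inj₂; [_,_]′)
open import Data.Vec using (Vec; []; _∷_; lookup; init; _∷ʳ_)
open import Function using (_∘_; id)
open import Relation.Binary.PropositionalEquality
open import Relation.Nullary using (¬_; yes; no)

private
  variable
    A : Set
    m : ℕ
    a b : Bool
    s : Maybe Bool

-- x ∈S S unfolds to ∀ i → lookup x i ∈M lookup S i.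
_∈M_ : Bool → Maybe Bool → Set
a ∈M s = ∀ b → s ≡ just b → a ≡ b

∈M-just : s ≡ just b → b ∈M s
∈M-just s≡b _ s≡c = just-injective (trans (sym s≡b) s≡c)

lookup-init : (v : Vec A (suc m)) (i : Fin m) → lookup (init v) i ≡ lookup v (inject₁ i)
lookup-init (_ ∷ _ ∷ _) zero    = refl
lookup-init (_ ∷ v)     (suc i) = lookup-init v i

∷ʳ-init-last : (v : Vec A (suc m)) → init v ∷ʳ lookup v (last m) ≡ v
∷ʳ-init-last (_ ∷ [])    = refl
∷ʳ-init-last (u ∷ _ ∷ v) = cong (u ∷_) (∷ʳ-init-last (_ ∷ v))

∀-∷ʳ : {P : Vec A (suc m) → Set} → (∀ v a → P (v ∷ʳ a)) → ∀ v → P v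
∀-∷ʳ {P = P} h v = subst P (∷ʳ-init-last v) (h (init v) _)

flip-last-∷ʳ : (x : State m) (a : Bool) → flip (last m) (x ∷ʳ a) ≡ x ∷ʳ not a
flip-last-∷ʳ []      _ = refl
flip-last-∷ʳ (u ∷ x) a = cong (u ∷_) (flip-last-∷ʳ x a)

∈S-∷ : (x : State m) (S : Subspace m) → a ∈M s → x ∈S S → (a ∷ x) ∈S (s ∷ S)
∈S-∷ _ _ a∈ _  zero    = a∈
∈S-∷ _ _ _  x∈ (suc i) = x∈ i

∈S-∷ʳ⁺ : (x : State m) (S : Subspace m) → x ∈S S → a ∈M s → (x ∷ʳ a) ∈S (S ∷ʳ s)
∈S-∷ʳ⁺ []      []      _  a∈ = ∈S-∷ [] [] a∈ λ ()
∈S-∷ʳ⁺ (_ ∷ x) (_ ∷ S) x∈ a∈ =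
  ∈S-∷ (x ∷ʳ _) (S ∷ʳ _) (x∈ zero) (∈S-∷ʳ⁺ x S (x∈ ∘ suc) a∈)

∈S-∷ʳ⁻ : (x : State m) (S : Subspace m) → (x ∷ʳ a) ∈S (S ∷ʳ s) → x ∈S S × a ∈M s
∈S-∷ʳ⁻ []      []      h = (λ ()) , h zero
∈S-∷ʳ⁻ (_ ∷ x) (_ ∷ S) h = map₁ (∈S-∷ x S (h zero)) (∈S-∷ʳ⁻ x S (h ∘ suc))

∈S-proj : (y : State (suc m)) (T : Subspace (suc m)) → y ∈S T → init y ∈S proj T
∈S-proj y T y∈ i b Ti≡b =
  trans (lookup-init y i) (y∈ (inject₁ i) b (trans (sym (lookup-init T i)) Ti≡b))

∈S-extend : (x : State m) (T : Subspace (suc m)) →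
  x ∈S proj T → a ∈M lookup T (last m) → (x ∷ʳ a) ∈S T
∈S-extend x T x∈ a∈ = subst ((x ∷ʳ _) ∈S_) (∷ʳ-init-last T) (∈S-∷ʳ⁺ x (proj T) x∈ a∈)

∷ʳ-mono-⊆S : (S S′ : Subspace m) → S ⊆S S′ → (S ∷ʳ s) ⊆S (S′ ∷ʳ s)
∷ʳ-mono-⊆S S S′ S⊆S′ = ∀-∷ʳ λ x a xa∈ →
  let x∈ , a∈ = ∈S-∷ʳ⁻ x S xa∈ in ∈S-∷ʳ⁺ x S′ (S⊆S′ x x∈) a∈

IsTrapSpace-∷ʳ : (f : BN (suc m)) (S : Subspace m) →
  (∀ x a → x ∈S S → a ∈M s → f (x ∷ʳ a) ∈S (S ∷ʳ s)) → IsTrapSpace f (S ∷ʳ s)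
IsTrapSpace-∷ʳ f S closed = ∀-∷ʳ λ x a xa∈ →
  let x∈ , a∈ = ∈S-∷ʳ⁻ x S xa∈ in closed x a x∈ a∈

regulates⊎agree-not : (f : BN (suc m)) (i : Fin (suc m)) (x : State m) (a : Bool) →
  Regulates f (last m) i ⊎ lookup (f (x ∷ʳ a)) i ≡ lookup (f (x ∷ʳ not a)) i
regulates⊎agree-not f i x a with lookup (f (x ∷ʳ a)) i ≟ lookup (f (x ∷ʳ not a)) i
... | yes agree  = inj₂ agree
... | no  differ =
  inj₁ (x ∷ʳ a , subst (λ y → lookup (f (x ∷ʳ a)) i ≢ lookup (f y) i)
                       (sym (flip-last-∷ʳ x a)) differ)

regulates⊎agree : (f : BN (suc m)) (i : Fin (suc m)) (x : State m) (a c : Bool) →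
  Regulates f (last m) i ⊎ lookup (f (x ∷ʳ a)) i ≡ lookup (f (x ∷ʳ c)) i
regulates⊎agree f i x false false = inj₂ refl
regulates⊎agree f i x false true  = regulates⊎agree-not f i x false
regulates⊎agree f i x true  false = regulates⊎agree-not f i x true
regulates⊎agree f i x true  true  = inj₂ refl

last-independent : (f : BN (suc m)) → ¬ Autoregulated f (last m) →
  ∀ x a c → lookup (f (x ∷ʳ a)) (last m) ≡ lookup (f (x ∷ʳ c)) (last m)
last-independent f nonauto x a c = [ ⊥-elim ∘ nonauto , id ]′ (regulates⊎agree f (last _) x a c)

module Reduction {m} {f : BN (suc m)} (nonauto : ¬ Autoregulated f (last m))
                 {T : Subspace (suc m)} (trap : IsTrapSpace f T) where

  lift : Subspace m → Subspace (suc m)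
  lift T′ = T′ ∷ʳ lookup T (last m)

  lift-⊆S : (T′ : Subspace m) → T′ ⊆S proj T → lift T′ ⊆S T
  lift-⊆S T′ T′⊆ = subst (lift T′ ⊆S_) (∷ʳ-init-last T) (∷ʳ-mono-⊆S T′ (proj T) T′⊆)

  σ-last-∈M : (x : State m) → x ∈S proj T →
    lookup (f (x ∷ʳ false)) (last m) ∈M lookup T (last m)
  σ-last-∈M x x∈ b Tn≡b = begin
    lookup (f (x ∷ʳ false)) (last m) ≡⟨ last-independent f nonauto x false b ⟩
    lookup (f (x ∷ʳ b)) (last m)     ≡⟨ trap _ (∈S-extend x T x∈ (∈M-just Tn≡b)) (last m) b Tn≡b ⟩
    b                                ∎
    where open ≡-Reasoning

  σ-∈S : (x : State m) → x ∈S proj T → σ f x ∈S T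
  σ-∈S x x∈ = ∈S-extend x T x∈ (σ-last-∈M x x∈)

  reduce-trap : IsTrapSpace (reduce f) (proj T)
  reduce-trap x x∈ = ∈S-proj _ T (trap (σ f x) (σ-∈S x x∈))

  reduce-minimal : (∀ U → IsTrapSpace f U → U ⊆S T → T ⊆S U) →
    (∀ T′ → IsTrapSpace (reduce f) T′ → T′ ⊆S proj T → IsTrapSpace f (lift T′)) →
    IsMinimalTrapSpace (reduce f) (proj T)
  reduce-minimal minimal lifts = reduce-trap , λ T′ trap′ T′⊆ x x∈ →
    let T⊆lift = minimal (lift T′) (lifts T′ trap′ T′⊆) (lift-⊆S T′ T′⊆)
    in proj₁ (∈S-∷ʳ⁻ x T′ (T⊆lift (σ f x) (σ-∈S x x∈)))

  lift-trap : (T′ : Subspace m) → T′ ⊆S proj T →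
    (∀ x a → x ∈S T′ → a ∈M lookup T (last m) → init (f (x ∷ʳ a)) ∈S T′) →
    IsTrapSpace f (lift T′)
  lift-trap T′ T′⊆ init-closed = IsTrapSpace-∷ʳ f T′ λ x a x∈ a∈ →
    subst (_∈S lift T′) (∷ʳ-init-last (f (x ∷ʳ a)))
      (∈S-∷ʳ⁺ (init (f (x ∷ʳ a))) T′ (init-closed x a x∈ a∈)
        (trap _ (∈S-extend x T (T′⊆ x x∈) a∈) (last m)))

  lift-trap-fixed-last : (T′ : Subspace m) → lookup T (last m) ≡ just b →
    IsTrapSpace (reduce f) T′ → T′ ⊆S proj T → IsTrapSpace f (lift T′)
  lift-trap-fixed-last {b = b} T′ Tn≡b trap′ T′⊆ = lift-trap T′ T′⊆ λ x a x∈ a∈ →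
    let σ≡ : σ f x ≡ x ∷ʳ a
        σ≡ = cong (x ∷ʳ_) (trans (σ-last-∈M x (T′⊆ x x∈) b Tn≡b) (sym (a∈ b Tn≡b)))
    in subst (λ y → init (f y) ∈S T′) σ≡ (trap′ x x∈)

  lift-trap-fixed-targets : (T′ : Subspace m) → (∀ i → Regulates f (last m) i → Fixed T i) →
    IsTrapSpace (reduce f) T′ → T′ ⊆S proj T → IsTrapSpace f (lift T′)
  lift-trap-fixed-targets T′ fixed trap′ T′⊆ = lift-trap T′ T′⊆ closed
    where
    closed : ∀ x a → x ∈S T′ → a ∈M lookup T (last m) → init (f (x ∷ʳ a)) ∈S T′
    closed x a x∈ a∈ j b T′j≡b = trans (lookup-init (f (x ∷ʳ a)) j)
      (component (regulates⊎agree f (inject₁ j) x a (lookup (f (x ∷ʳ false)) (last m))))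
      where
      open ≡-Reasoning
      component : Regulates f (last m) (inject₁ j)
                  ⊎ lookup (f (x ∷ʳ a)) (inject₁ j) ≡ lookup (f (σ f x)) (inject₁ j) →
                  lookup (f (x ∷ʳ a)) (inject₁ j) ≡ b
      component (inj₂ agree) = begin
        lookup (f (x ∷ʳ a)) (inject₁ j) ≡⟨ agree ⟩
        lookup (f (σ f x)) (inject₁ j)  ≡⟨ lookup-init (f (σ f x)) j ⟨
        lookup (reduce f x) j           ≡⟨ trap′ x x∈ j b T′j≡b ⟩
        b                               ∎
      component (inj₁ regulates) = let c , Tj≡c = fixed (inject₁ j) regulates in begin
        lookup (f (x ∷ʳ a)) (inject₁ j) ≡⟨ trap _ (∈S-extend x T (T′⊆ x x∈) a∈) _ c Tj≡c ⟩
        c                               ≡⟨ T′⊆ x x∈ j c (trans (lookup-init T j) Tj≡c) ⟨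
        lookup x j                      ≡⟨ x∈ j b T′j≡b ⟩
        b                               ∎

proposition2 : (m : ℕ) (f : BN (suc m)) →
    ¬ Autoregulated f (last m) →
    (T : Subspace (suc m)) → IsTrapSpace f T →
      IsTrapSpace (reduce f) (proj T)
      × (IsMinimalTrapSpace f T → Fixed T (last m) →
           IsMinimalTrapSpace (reduce f) (proj T))
      × (IsMinimalTrapSpace f T →
           (∀ i → Regulates f (last m) i → Fixed T i) →
           IsMinimalTrapSpace (reduce f) (proj T))
proposition2 m f nonauto T trap =
    reduce-trap
  , (λ (_ , minimal) (_ , Tn≡b) → reduce-minimal minimal λ T′ → lift-trap-fixed-last T′ Tn≡b)
  , (λ (_ , minimal) fixed → reduce-minimal minimal λ T′ → lift-trap-fixed-targets T′ fixed)
  where open Reduction {f = f} nonauto {T = T} trap
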